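{- Let $L$ be an environment, $T_1$ a term and $A$ an arity with $L\vdash T_1::A$. Then for every $n\in\mathbb N$ there exists a term $T_2$ such that $L\vdash T_1\to^{*n}T_2$ and $T_2$ is r-normal in $L$.
   Context: Fix a nonempty set $\Sigma$ of sorts with decidable equality, an arbitrary function $\mathrm{next}:\Sigma\to\Sigma$, and a countably infinite set of variables. Terms and environments: $T,U,V,W ::= \star s \mid x \mid \mathrm{app}(V,T) \mid \lambda x{:}W.\,T \mid \mathrm{def}(x{=}V).\,T \mid \mathrm{cast}(U,T)$ ($s\in\Sigma$) and $L,K ::= \emptyset \mid K,x{:}W \mid K,x{=}V$. $\mathrm{app}(V,T)$ applies $T$ to $V$; $\lambda x{:}W.\,T$ (de Bruijn's abstraction) and $\mathrm{def}(x{=}V).\,T$ (local definition) bind $x$ in $T$; $\mathrm{cast}(U,T)$ annotates $T$ with expected type $U$; entries $x{:}W$ and $x{=}V$ bind $x$. Terms are modulo renaming of bound variables. Write $\mathsf{B}x[V]$ for either $\lambda x{:}V$ or $\mathrm{def}(x{=}V)$ and correspondingly $L,x[V]$ for $L,x{:}V$ resp. $L,x{=}V$. One step of bound rt-reduction $L\vdash T_1\to^nT_2$ is the smallest relation closed under: $L\vdash\mathrm{app}(V,\lambda x{:}W.\,T)\to^0\mathrm{def}(x{=}\mathrm{cast}(W,V)).\,T$; $K,x{=}V\vdash x\to^0V$; $L\vdash\mathrm{def}(x{=}V).\,T\to^0T$ if $x$ not free in $T$; $L\vdash\mathrm{app}(V,\mathrm{def}(x{=}W).\,T)\to^0\mathrm{def}(x{=}W).\,\mathrm{app}(V,T)$;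 $L\vdash\mathrm{cast}(U,T)\to^0T$; $L\vdash\star s\to^1\star\,\mathrm{next}(s)$; $K,x{:}W\vdash x\to^1W$; $L\vdash\mathrm{cast}(U,T)\to^1U$; if $K\vdash x\to^nT$, $y\neq x$, $y$ not free in $T$ then $K,y[V]\vdash x\to^nT$; if $L\vdash V_1\to^0V_2$ then $L\vdash\mathrm{app}(V_1,T)\to^0\mathrm{app}(V_2,T)$; if $L\vdash T_1\to^nT_2$ then $L\vdash\mathrm{app}(V,T_1)\to^n\mathrm{app}(V,T_2)$; if $L\vdash V_1\to^0V_2$ then $L\vdash\mathsf Bx[V_1].\,T\to^0\mathsf Bx[V_2].\,T$; if $L,x[V]\vdash T_1\to^nT_2$ then $L\vdash\mathsf Bx[V].\,T_1\to^n\mathsf Bx[V].\,T_2$; if $L\vdash U_1\to^0U_2$ then $L\vdash\mathrm{cast}(U_1,T)\to^0\mathrm{cast}(U_2,T)$; if $L\vdash T_1\to^0T_2$ then $L\vdash\mathrm{cast}(U,T_1)\to^0\mathrm{cast}(U,T_2)$; if $L\vdash U_1\to^1U_2$ and $L\vdash T_1\to^1T_2$ then $L\vdash\mathrm{cast}(U_1,T_1)\to^1\mathrm{cast}(U_2,T_2)$. $L\vdash T_1\to^{*n}T_2$ is the smallest relation with $L\vdash T\to^{*0}T$, containing single steps, and with $L\vdash T_1\to^{*n_1}T$, $L\vdash T\to^{*n_2}T_2$ implying $L\vdash T_1\to^{*n_1+n_2}T_2$. A term $T$ is r-normal in $L$ if every $T'$ with $L\vdash T\to^{*0}T'$ equals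 $T$. Arities are $A,B::=\circ\mid B\Rightarrow A$. Arity assignment $L\vdash T::A$ is the smallest relation closed under: $L\vdash\star s::\circ$; if $K\vdash V::A$ then $K,x[V]\vdash x::A$; if $K\vdash x::A$ and $y\neq x$ then $K,y[V]\vdash x::A$; if $L\vdash W::B$ and $L,x{:}W\vdash T::A$ then $L\vdash\lambda x{:}W.\,T::B\Rightarrow A$; if $L\vdash V::B$ and $L,x{=}V\vdash T::A$ then $L\vdash\mathrm{def}(x{=}V).\,T::A$; if $L\vdash V::B$ and $L\vdash T::B\Rightarrow A$ then $L\vdash\mathrm{app}(V,T)::A$; if $L\vdash U::A$ and $L\vdash T::A$ then $L\vdash\mathrm{cast}(U,T)::A$. -}

module Defs where

open import Data.Nat using (ℕ; zero; suc; _+_; _<ᵇ_)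
open import Data.Bool using (if_then_else_)
open import Relation.Binary.PropositionalEquality using (_≡_)

-- Terms with de Bruijn indices (terms are taken modulo renaming of bound
-- variables, so de Bruijn indices represent them exactly).
-- B x[V] : abst = λ x:V (de Bruijn's abstraction), abbr = def(x=V) (local definition)
data Bind : Set where
  abst abbr : Bind

data Term (S : Set) : Set where
  sort : S → Term S
  var  : ℕ → Term S
  app  : Term S → Term S → Term S        -- app V T  (T applied to V)
  bind : Bind → Term S → Term S → Term S -- bind b V T  =  B x[V]. T   (binds index 0 in T)
  cast : Term S → Term S → Term S

-- environments:  ∅  |  L , x[V]   (the most recent entry is index 0)
data Env (S : Set) : Set where
  ∅   : Env S
  _,_[_] : Env S → Bind → Term S → Env S

lift : {S : Set} → ℕ → Term S → Term S
lift c (sort s)     = sort s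
lift c (var i)      = if i <ᵇ c then var i else var (suc i)
lift c (app V T)    = app (lift c V) (lift c T)
lift c (bind b V T) = bind b (lift c V) (lift (suc c) T)
lift c (cast U T)   = cast (lift c U) (lift c T)

-- the term T with the free variable x (index 0) absent corresponds to  lift 0 T'
↑ : {S : Set} → Term S → Term S
↑ = lift 0

data Step {S : Set} (next : S → S) : Env S → Term S → ℕ → Term S → Set where
  beta  : ∀ {L V W T} → Step next L (app V (bind abst W T)) 0 (bind abbr (cast W V) T)
  delta : ∀ {K V} → Step next (K , abbr [ V ]) (var 0) 0 (↑ V)
  zeta  : ∀ {L V T} → Step next L (bind abbr V (↑ T)) 0 T
  theta : ∀ {L V W T} → Step next L (app V (bind abbr W T)) 0 (bind abbr W (app (↑ V) T))
  eps   : ∀ {L U T} → Step next L (cast U T) 0 T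
  sortS : ∀ {L s} → Step next L (sort s) 1 (sort (next s))
  ell   : ∀ {K W} → Step next (K , abst [ W ]) (var 0) 1 (↑ W)
  ee    : ∀ {L U T} → Step next L (cast U T) 1 U
  lref  : ∀ {K b V i n T} → Step next K (var i) n T →
          Step next (K , b [ V ]) (var (suc i)) n (↑ T)
  appV  : ∀ {L V₁ V₂ T} → Step next L V₁ 0 V₂ → Step next L (app V₁ T) 0 (app V₂ T)
  appT  : ∀ {L V T₁ T₂ n} → Step next L T₁ n T₂ → Step next L (app V T₁) n (app V T₂)
  bindV : ∀ {L b V₁ V₂ T} → Step next L V₁ 0 V₂ → Step next L (bind b V₁ T) 0 (bind b V₂ T)
  bindT : ∀ {L b V T₁ T₂ n} → Step next (L , b [ V ]) T₁ n T₂ →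
          Step next L (bind b V T₁) n (bind b V T₂)
  castU : ∀ {L U₁ U₂ T} → Step next L U₁ 0 U₂ → Step next L (cast U₁ T) 0 (cast U₂ T)
  castT : ∀ {L U T₁ T₂} → Step next L T₁ 0 T₂ → Step next L (cast U T₁) 0 (cast U T₂)
  castB : ∀ {L U₁ U₂ T₁ T₂} → Step next L U₁ 1 U₂ → Step next L T₁ 1 T₂ →
          Step next L (cast U₁ T₁) 1 (cast U₂ T₂)

data Steps {S : Set} (next : S → S) : Env S → Term S → ℕ → Term S → Set where
  refl*  : ∀ {L T} → Steps next L T 0 T
  step*  : ∀ {L T₁ n T₂} → Step next L T₁ n T₂ → Steps next L T₁ n T₂
  trans* : ∀ {L T₁ T T₂ n₁ n₂} → Steps next L T₁ n₁ T → Steps next L T n₂ T₂ →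
           Steps next L T₁ (n₁ + n₂) T₂

RNormal : {S : Set} → (S → S) → Env S → Term S → Set
RNormal next L T = ∀ T' → Steps next L T 0 T' → T' ≡ T

data Arity : Set where
  ○    : Arity
  _⇒_ : Arity → Arity → Arity

data HasArity {S : Set} : Env S → Term S → Arity → Set where
  aSort : ∀ {L s} → HasArity L (sort s) ○
  aZero : ∀ {K b V A} → HasArity K V A → HasArity (K , b [ V ]) (var 0) A
  aSuc  : ∀ {K b V i A} → HasArity K (var i) A → HasArity (K , b [ V ]) (var (suc i)) A
  aAbst : ∀ {L W T A B} → HasArity L W B → HasArity (L , abst [ W ]) T A →
          HasArity L (bind abst W T) (B ⇒ A)
  aAbbr : ∀ {L V T A B} → HasArity L V B → HasArity (L , abbr [ V ]) T A →
          HasArity L (bind abbr V T) A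
  aApp  : ∀ {L V T A B} → HasArity L V B → HasArity L T (B ⇒ A) → HasArity L (app V T) A
  aCast : ∀ {L U T A} → HasArity L U A → HasArity L T A → HasArity L (cast U T) A

-- The proof has two independent halves.
--  * Sort-raising steps: a term with an arity always admits a single →¹ step
--    to a term with the same arity (raise a sort, expand a λ-bound variable to
--    its type, or take the type of a cast, possibly under binders or through a
--    δ-expansion).  Iterating gives an n-step reduct that still has an arity.
--  * Weak normalisation: a term with an arity reduces by →⁰ steps to a
--    syntactic normal form (sorts, λ-abstractions and neutral applications
--    headed by λ-bound variables), and syntactic normal forms are r-normal.
--    This is Tait's reducibility method: reducible terms of arity B ⇒ A are
--    those whose applications to reducible arguments, in every extension of
--    the environment, are reducible of arity A.  The fundamental lemma is
--    proved for environments in which λ-entries may be instantiated by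
--    reducible definitions, which handles β (it creates such a definition).

module Submission where

open import Defs
open import Data.Nat using (ℕ; zero; suc; _<ᵇ_)
open import Data.Nat.Properties using (m+n≡0⇒m≡0; m+n≡0⇒n≡0; +-identityʳ)
open import Data.Bool using (true; false)
open import Data.List using (List; []; _∷_; _++_; length)
open import Data.Product using (Σ; _×_; _,_; proj₁)
open import Data.Empty using (⊥; ⊥-elim)
open import Relation.Binary.Definitions using (DecidableEquality)
open import Relation.Binary.Construct.Closure.ReflexiveTransitive
  using (Star; ε; _◅_; _◅◅_; gmap)
open import Relation.Binary.PropositionalEquality
  using (_≡_; refl; sym; trans; cong; cong₂; subst; subst₂; module ≡-Reasoning)

data OPE : Set where
  id   : OPE
  skip : OPE → OPE
  keep : OPE → OPE

renVar : OPE → ℕ → ℕ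
renVar id       i       = i
renVar (skip ρ) i       = suc (renVar ρ i)
renVar (keep ρ) zero    = zero
renVar (keep ρ) (suc i) = suc (renVar ρ i)

-- Composition: first ρ, then σ.
_∘_ : OPE → OPE → OPE
id     ∘ ρ      = ρ
skip σ ∘ ρ      = skip (σ ∘ ρ)
keep σ ∘ id     = keep σ
keep σ ∘ skip ρ = skip (σ ∘ ρ)
keep σ ∘ keep ρ = keep (σ ∘ ρ)

renVar-∘ : ∀ σ ρ i → renVar (σ ∘ ρ) i ≡ renVar σ (renVar ρ i)
renVar-∘ id       ρ        i       = refl
renVar-∘ (skip σ) ρ        i       = cong suc (renVar-∘ σ ρ i)
renVar-∘ (keep σ) id       i       = refl
renVar-∘ (keep σ) (skip ρ) i       = cong suc (renVar-∘ σ ρ i)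
renVar-∘ (keep σ) (keep ρ) zero    = refl
renVar-∘ (keep σ) (keep ρ) (suc i) = cong suc (renVar-∘ σ ρ i)

IsId : OPE → Set
IsId ρ = ∀ i → renVar ρ i ≡ i

wk : OPE
wk = skip id

keeps : ℕ → OPE → OPE
keeps zero    ρ = ρ
keeps (suc c) ρ = keep (keeps c ρ)

data AbstVar : List Bind → ℕ → Set where
  here  : ∀ {bs} → AbstVar (abst ∷ bs) 0
  there : ∀ {b bs i} → AbstVar bs i → AbstVar (b ∷ bs) (suc i)

module _ {S : Set} where

  ren : OPE → Term S → Term S
  ren ρ (sort s)     = sort s
  ren ρ (var i)      = var (renVar ρ i)
  ren ρ (app V T)    = app (ren ρ V) (ren ρ T)
  ren ρ (bind b V T) = bind b (ren ρ V) (ren (keep ρ) T)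
  ren ρ (cast U T)   = cast (ren ρ U) (ren ρ T)

  ren-ext : ∀ {ρ σ} → (∀ i → renVar ρ i ≡ renVar σ i) → ∀ T → ren ρ T ≡ ren σ T
  ren-ext e (sort s)     = refl
  ren-ext e (var i)      = cong var (e i)
  ren-ext e (app V T)    = cong₂ app (ren-ext e V) (ren-ext e T)
  ren-ext e (bind b V T) = cong₂ (bind b) (ren-ext e V) (ren-ext e′ T)
    where
      e′ : ∀ i → renVar (keep _) i ≡ renVar (keep _) i
      e′ zero    = refl
      e′ (suc i) = cong suc (e i)
  ren-ext e (cast U T)   = cong₂ cast (ren-ext e U) (ren-ext e T)

  ren-∘ : ∀ σ ρ T → ren (σ ∘ ρ) T ≡ ren σ (ren ρ T)
  ren-∘ σ ρ (sort s)     = refl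
  ren-∘ σ ρ (var i)      = cong var (renVar-∘ σ ρ i)
  ren-∘ σ ρ (app V T)    = cong₂ app (ren-∘ σ ρ V) (ren-∘ σ ρ T)
  ren-∘ σ ρ (bind b V T) = cong₂ (bind b) (ren-∘ σ ρ V) (ren-∘ (keep σ) (keep ρ) T)
  ren-∘ σ ρ (cast U T)   = cong₂ cast (ren-∘ σ ρ U) (ren-∘ σ ρ T)

  ren-IsId : ∀ {ρ} → IsId ρ → ∀ T → ren ρ T ≡ T
  ren-IsId p (sort s)     = refl
  ren-IsId p (var i)      = cong var (p i)
  ren-IsId p (app V T)    = cong₂ app (ren-IsId p V) (ren-IsId p T)
  ren-IsId p (bind b V T) = cong₂ (bind b) (ren-IsId p V) (ren-IsId p′ T)
    where
      p′ : IsId (keep _)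
      p′ zero    = refl
      p′ (suc i) = cong suc (p i)
  ren-IsId p (cast U T)   = cong₂ cast (ren-IsId p U) (ren-IsId p T)

  ren-id : ∀ T → ren id T ≡ T
  ren-id = ren-IsId (λ _ → refl)

  sucVar : Term S → Term S
  sucVar (var k) = var (suc k)
  sucVar T       = T

  lift-sucVar : ∀ c j → lift {S} (suc c) (var (suc j)) ≡ sucVar (lift c (var j))
  lift-sucVar c j with j <ᵇ c
  ... | true  = refl
  ... | false = refl

  lift≡ren : ∀ c T → lift c T ≡ ren (keeps c wk) T
  lift≡ren c       (sort s)     = refl
  lift≡ren zero    (var i)      = refl
  lift≡ren (suc c) (var zero)   = refl
  lift≡ren (suc c) (var (suc i)) = trans (lift-sucVar c i) (cong sucVar (lift≡ren c (var i)))
  lift≡ren c       (app V T)    = cong₂ app (lift≡ren c V) (lift≡ren c T)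
  lift≡ren c       (bind b V T) = cong₂ (bind b) (lift≡ren c V) (lift≡ren (suc c) T)
  lift≡ren c       (cast U T)   = cong₂ cast (lift≡ren c U) (lift≡ren c T)

  ↑-ren : ∀ ρ V → ↑ (ren ρ V) ≡ ren (keep ρ) (↑ V)
  ↑-ren ρ V = begin
      ↑ (ren ρ V)             ≡⟨ lift≡ren 0 (ren ρ V) ⟩
      ren wk (ren ρ V)        ≡⟨ sym (ren-∘ wk ρ V) ⟩
      ren (wk ∘ ρ) V          ≡⟨ ren-ext (λ i → cong suc (sym (renVar-∘ ρ id i))) V ⟩
      ren (keep ρ ∘ wk) V     ≡⟨ ren-∘ (keep ρ) wk V ⟩
      ren (keep ρ) (ren wk V) ≡⟨ cong (ren (keep ρ)) (sym (lift≡ren 0 V)) ⟩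
      ren (keep ρ) (↑ V)      ∎
    where open ≡-Reasoning

  ren-skip : ∀ ρ T → ren (skip ρ) T ≡ ↑ (ren ρ T)
  ren-skip ρ T = trans (ren-∘ wk ρ T) (sym (lift≡ren 0 (ren ρ T)))

  data _⊇[_]_ : Env S → OPE → Env S → Set where
    ⊇-id   : ∀ {L} → L ⊇[ id ] L
    ⊇-skip : ∀ {L′ ρ L b X} → L′ ⊇[ ρ ] L → (L′ , b [ X ]) ⊇[ skip ρ ] L
    ⊇-keep : ∀ {L′ ρ L b V} → L′ ⊇[ ρ ] L → (L′ , b [ ren ρ V ]) ⊇[ keep ρ ] (L , b [ V ])

  ⊇-∘ : ∀ {L″ σ L′ ρ L} → L″ ⊇[ σ ] L′ → L′ ⊇[ ρ ] L → L″ ⊇[ σ ∘ ρ ] L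
  ⊇-∘ ⊇-id       r          = r
  ⊇-∘ (⊇-skip s) r          = ⊇-skip (⊇-∘ s r)
  ⊇-∘ (⊇-keep s) ⊇-id       = ⊇-keep s
  ⊇-∘ (⊇-keep s) (⊇-skip r) = ⊇-skip (⊇-∘ s r)
  ⊇-∘ {σ = keep σ} (⊇-keep {L′ = L″} {b = b} s) (⊇-keep {ρ = ρ} {L = L} {V = V} r) =
    subst (λ X → (L″ , b [ X ]) ⊇[ keep (σ ∘ ρ) ] (L , b [ V ])) (ren-∘ σ ρ V)
          (⊇-keep (⊇-∘ s r))

  ⊇-wk : ∀ {L b X} → (L , b [ X ]) ⊇[ wk ] L
  ⊇-wk = ⊇-skip ⊇-id

  arity-unique : ∀ {L T A B} → HasArity {S} L T A → HasArity L T B → A ≡ B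
  arity-unique aSort       aSort         = refl
  arity-unique (aZero d)   (aZero d′)    = arity-unique d d′
  arity-unique (aSuc d)    (aSuc d′)     = arity-unique d d′
  arity-unique (aAbst d e) (aAbst d′ e′) = cong₂ _⇒_ (arity-unique d d′) (arity-unique e e′)
  arity-unique (aAbbr d e) (aAbbr d′ e′) = arity-unique e e′
  arity-unique (aApp d e)  (aApp d′ e′)  with arity-unique e e′
  ... | refl = refl
  arity-unique (aCast d e) (aCast d′ e′) = arity-unique e e′

  arity-ren : ∀ {L′ ρ L T A} → L′ ⊇[ ρ ] L → HasArity L T A → HasArity L′ (ren ρ T) A
  arity-ren {T = T} {A} ⊇-id d = subst (λ X → HasArity _ X A) (sym (ren-id T)) d
  arity-ren (⊇-skip s) (aZero d)   = aSuc (arity-ren s (aZero d))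
  arity-ren (⊇-skip s) (aSuc d)    = aSuc (arity-ren s (aSuc d))
  arity-ren (⊇-keep s) (aZero d)   = aZero (arity-ren s d)
  arity-ren (⊇-keep s) (aSuc d)    = aSuc (arity-ren s d)
  arity-ren s          aSort       = aSort
  arity-ren s          (aAbst d e) = aAbst (arity-ren s d) (arity-ren (⊇-keep s) e)
  arity-ren s          (aAbbr d e) = aAbbr (arity-ren s d) (arity-ren (⊇-keep s) e)
  arity-ren s          (aApp d e)  = aApp (arity-ren s d) (arity-ren s e)
  arity-ren s          (aCast d e) = aCast (arity-ren s d) (arity-ren s e)

  arity-↑ : ∀ {L b X T A} → HasArity L T A → HasArity (L , b [ X ]) (↑ T) A
  arity-↑ {T = T} {A} d = subst (λ X → HasArity _ X A) (sym (lift≡ren 0 T)) (arity-ren ⊇-wk d)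

  -- The list of binder kinds of an environment; normal forms depend only on it.
  binders : Env S → List Bind
  binders ∅             = []
  binders (L , b [ V ]) = b ∷ binders L

  data Neutral (bs : List Bind) : Term S → Set
  data Normal  (bs : List Bind) : Term S → Set
  data Neutral bs where
    nvar : ∀ {i} → AbstVar bs i → Neutral bs (var i)
    napp : ∀ {V T} → Normal bs V → Neutral bs T → Neutral bs (app V T)
  data Normal bs where
    nsort : ∀ {s} → Normal bs (sort s)
    nne   : ∀ {T} → Neutral bs T → Normal bs T
    nlam  : ∀ {W T} → Normal bs W → Normal (abst ∷ bs) T → Normal bs (bind abst W T)

  abstVar-ren : ∀ {L′ ρ L i} → L′ ⊇[ ρ ] L → AbstVar (binders L) i →
                AbstVar (binders L′) (renVar ρ i)
  abstVar-ren ⊇-id       p         = p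
  abstVar-ren (⊇-skip s) p         = there (abstVar-ren s p)
  abstVar-ren (⊇-keep s) here      = here
  abstVar-ren (⊇-keep s) (there p) = there (abstVar-ren s p)

  neutral-ren : ∀ {L′ ρ L T} → L′ ⊇[ ρ ] L → Neutral (binders L) T → Neutral (binders L′) (ren ρ T)
  normal-ren  : ∀ {L′ ρ L T} → L′ ⊇[ ρ ] L → Normal (binders L) T → Normal (binders L′) (ren ρ T)
  neutral-ren s (nvar p)   = nvar (abstVar-ren s p)
  neutral-ren s (napp v t) = napp (normal-ren s v) (neutral-ren s t)
  normal-ren s nsort                 = nsort
  normal-ren s (nne t)               = nne (neutral-ren s t)
  normal-ren s (nlam {W = W} w t)    = nlam (normal-ren s w) (normal-ren (⊇-keep {V = W} s) t)

  -- Strengthening: a normal form in a context containing a definition does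
  -- not mention the defined variable (it is a shift of a normal form without
  -- it).  This is what lets a definition around a normal form be dropped by ζ.
  strengthen-var : ∀ bs₁ {bs₂ i} → AbstVar (bs₁ ++ abbr ∷ bs₂) i →
                   Σ ℕ (λ j → lift {S} (length bs₁) (var j) ≡ var i × AbstVar (bs₁ ++ bs₂) j)
  strengthen-var []         (there {i = j} p) = j , refl , p
  strengthen-var (abst ∷ bs₁) here            = 0 , refl , here
  strengthen-var (b ∷ bs₁)  (there p) with strengthen-var bs₁ p
  ... | j , e , q = suc j , trans (lift-sucVar (length bs₁) j) (cong sucVar e) , there q

  strengthen-neutral : ∀ bs₁ {bs₂ T} → Neutral (bs₁ ++ abbr ∷ bs₂) T →
    Σ (Term S) (λ T₀ → T ≡ lift (length bs₁) T₀ × Neutral (bs₁ ++ bs₂) T₀)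
  strengthen-normal : ∀ bs₁ {bs₂ T} → Normal (bs₁ ++ abbr ∷ bs₂) T →
    Σ (Term S) (λ T₀ → T ≡ lift (length bs₁) T₀ × Normal (bs₁ ++ bs₂) T₀)
  strengthen-neutral bs₁ (nvar p) with strengthen-var bs₁ p
  ... | j , e , q = var j , sym e , nvar q
  strengthen-neutral bs₁ (napp v t) with strengthen-normal bs₁ v | strengthen-neutral bs₁ t
  ... | V₀ , e₁ , v′ | T₀ , e₂ , t′ = app V₀ T₀ , cong₂ app e₁ e₂ , napp v′ t′
  strengthen-normal bs₁ nsort = sort _ , refl , nsort
  strengthen-normal bs₁ (nne t) with strengthen-neutral bs₁ t
  ... | T₀ , e , t′ = T₀ , e , nne t′
  strengthen-normal bs₁ (nlam w t) with strengthen-normal bs₁ w | strengthen-normal (abst ∷ bs₁) t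
  ... | W₀ , e₁ , w′ | T₀ , e₂ , t′ = bind abst W₀ T₀ , cong₂ (bind abst) e₁ e₂ , nlam w′ t′

module _ {S : Set} (next : S → S) where

  steps-map : ∀ {L L′} (f : Term S → Term S) →
              (∀ {T n T′} → Step next L T n T′ → Step next L′ (f T) n (f T′)) →
              ∀ {T n T′} → Steps next L T n T′ → Steps next L′ (f T) n (f T′)
  steps-map f g refl*        = refl*
  steps-map f g (step* s)    = step* (g s)
  steps-map f g (trans* p q) = trans* (steps-map f g p) (steps-map f g q)

  step-ren : ∀ {L′ ρ L T₁ n T₂} → L′ ⊇[ ρ ] L → Step next L T₁ n T₂ →
             Step next L′ (ren ρ T₁) n (ren ρ T₂)
  step-ren {T₁ = T₁} {n} {T₂} ⊇-id st =
    subst₂ (λ X Y → Step next _ X n Y) (sym (ren-id T₁)) (sym (ren-id T₂)) st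
  step-ren {ρ = skip ρ} {T₁ = var i} {n} {T₂} (⊇-skip s) st =
    subst (Step next _ _ n) (sym (ren-skip ρ T₂)) (lref (step-ren s st))
  step-ren {ρ = keep ρ} (⊇-keep {V = V} s) delta =
    subst (Step next _ (var 0) 0) (↑-ren ρ V) delta
  step-ren {ρ = keep ρ} (⊇-keep {V = V} s) ell =
    subst (Step next _ (var 0) 1) (↑-ren ρ V) ell
  step-ren {ρ = keep ρ} {n = n} (⊇-keep s) (lref {T = T} st) =
    subst (Step next _ _ n) (↑-ren ρ T) (lref (step-ren s st))
  step-ren {ρ = ρ} s (zeta {V = V} {T = T}) =
    subst (λ X → Step next _ (bind abbr (ren ρ V) X) 0 (ren ρ T)) (↑-ren ρ T) zeta
  step-ren {ρ = ρ} s (theta {V = V} {W} {T}) =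
    subst (λ X → Step next _ (app (ren ρ V) (bind abbr (ren ρ W) (ren (keep ρ) T))) 0
                              (bind abbr (ren ρ W) (app X (ren (keep ρ) T))))
          (↑-ren ρ V) theta
  step-ren s beta            = beta
  step-ren s eps             = eps
  step-ren s sortS           = sortS
  step-ren s ee              = ee
  step-ren s (appV st)       = appV (step-ren s st)
  step-ren s (appT st)       = appT (step-ren s st)
  step-ren s (bindV st)      = bindV (step-ren s st)
  step-ren s (bindT st)      = bindT (step-ren (⊇-keep s) st)
  step-ren s (castU st)      = castU (step-ren s st)
  step-ren s (castT st)      = castT (step-ren s st)
  step-ren s (castB st st′)  = castB (step-ren s st) (step-ren s st′)

  steps-↑ : ∀ {L b X T n T′} → Steps next L T n T′ → Steps next (L , b [ X ]) (↑ T) n (↑ T′)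
  steps-↑ {T = T} {n} {T′} st =
    subst₂ (λ Y Z → Steps next _ Y n Z) (sym (lift≡ren 0 T)) (sym (lift≡ren 0 T′))
           (steps-map (ren wk) (step-ren ⊇-wk) st)

  one-step : ∀ {L T A} → HasArity L T A →
             Σ (Term S) (λ T′ → Steps next L T 1 T′ × HasArity L T′ A)
  one-step aSort                 = _ , step* sortS , aSort
  one-step (aZero {b = abst} d)  = _ , step* ell , arity-↑ d
  one-step (aZero {b = abbr} d)  with one-step d
  ... | V′ , st , d′ = ↑ V′ , trans* (step* delta) (steps-↑ st) , arity-↑ d′
  one-step (aSuc d)    with one-step d
  ... | T′ , st , d′ = ↑ T′ , steps-↑ st , arity-↑ d′
  one-step (aAbst d e) with one-step e
  ... | T′ , st , e′ = _ , steps-map (bind abst _) bindT st , aAbst d e′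
  one-step (aAbbr d e) with one-step e
  ... | T′ , st , e′ = _ , steps-map (bind abbr _) bindT st , aAbbr d e′
  one-step (aApp d e)  with one-step e
  ... | T′ , st , e′ = _ , steps-map (app _) appT st , aApp d e′
  one-step (aCast d e) = _ , step* ee , d

  n-steps : ∀ {L T A} n → HasArity L T A →
            Σ (Term S) (λ T′ → Steps next L T n T′ × HasArity L T′ A)
  n-steps zero    d = _ , refl* , d
  n-steps (suc n) d with one-step d
  ... | T₁ , st₁ , d₁ with n-steps n d₁
  ... | T₂ , st₂ , d₂ = T₂ , trans* st₁ st₂ , d₂

  _⊢_⟶₀*_ : Env S → Term S → Term S → Set
  L ⊢ T ⟶₀* T′ = Star (λ X Y → Step next L X 0 Y) T T′

  ⟶₀*⇒Steps : ∀ {L T T′} → L ⊢ T ⟶₀* T′ → Steps next L T 0 T′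
  ⟶₀*⇒Steps ε        = refl*
  ⟶₀*⇒Steps (s ◅ ss) = trans* (step* s) (⟶₀*⇒Steps ss)

  ⟶₀*-ren : ∀ {L′ ρ L T T′} → L′ ⊇[ ρ ] L → L ⊢ T ⟶₀* T′ → L′ ⊢ ren ρ T ⟶₀* ren ρ T′
  ⟶₀*-ren s = gmap (ren _) (step-ren s)

  abstVar-irreducible : ∀ {L : Env S} {i T′} → AbstVar (binders L) i → Step next L (var i) 0 T′ → ⊥
  abstVar-irreducible {L , abbr [ V ]} () delta
  abstVar-irreducible {L , b [ V ]} (there p) (lref st) = abstVar-irreducible p st

  neutral-irreducible : ∀ {L T T′} → Neutral (binders L) T → Step next L T 0 T′ → ⊥
  normal-irreducible  : ∀ {L T T′} → Normal (binders L) T → Step next L T 0 T′ → ⊥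
  neutral-irreducible (nvar p)   st        = abstVar-irreducible p st
  neutral-irreducible (napp v t) (appV st) = normal-irreducible v st
  neutral-irreducible (napp v t) (appT st) = neutral-irreducible t st
  normal-irreducible (nne t)    st         = neutral-irreducible t st
  normal-irreducible (nlam w t) (bindV st) = normal-irreducible w st
  normal-irreducible (nlam w t) (bindT st) = normal-irreducible t st

  normal-steps₀ : ∀ {L T n T′} → Normal (binders L) T → Steps next L T n T′ → n ≡ 0 → T′ ≡ T
  normal-steps₀ nf refl*     _    = refl
  normal-steps₀ nf (step* st) refl = ⊥-elim (normal-irreducible nf st)
  normal-steps₀ nf (trans* {n₁ = n₁} p q) e with normal-steps₀ nf p (m+n≡0⇒m≡0 n₁ e)
  ... | refl = normal-steps₀ nf q (m+n≡0⇒n≡0 n₁ e)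

  normal⇒RNormal : ∀ {L T} → Normal (binders L) T → RNormal next L T
  normal⇒RNormal nf T′ st = normal-steps₀ nf st refl

  WN : Env S → Term S → Set
  WN L T = Σ (Term S) (λ N → L ⊢ T ⟶₀* N × Normal (binders L) N)

  WN-ren : ∀ {L′ ρ L T} → L′ ⊇[ ρ ] L → WN L T → WN L′ (ren ρ T)
  WN-ren s (N , st , nf) = ren _ N , ⟶₀*-ren s st , normal-ren s nf

  -- A normalising body yields a normalising definition: reduce the body,
  -- then drop the now unused definition by ζ.
  WN-def : ∀ {L X T} → WN (L , abbr [ X ]) T → WN L (bind abbr X T)
  WN-def {X = X} (N , st , nf) with strengthen-normal [] nf
  ... | N₀ , refl , nf₀ = N₀ , gmap (bind abbr X) bindT st ◅◅ (zeta ◅ ε) , nf₀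

  Reducible : Arity → Env S → Term S → Set
  Reducible ○       L T = WN L T
  Reducible (B ⇒ A) L T =
    WN L T × (∀ {L′ ρ} → L′ ⊇[ ρ ] L → ∀ V → Reducible B L′ V → Reducible A L′ (app V (ren ρ T)))

  reducible⇒WN : ∀ A {L T} → Reducible A L T → WN L T
  reducible⇒WN ○       r = r
  reducible⇒WN (B ⇒ A) r = proj₁ r

  reducible-ren : ∀ A {L′ ρ L T} → L′ ⊇[ ρ ] L → Reducible A L T → Reducible A L′ (ren ρ T)
  reducible-ren ○       s r = WN-ren s r
  reducible-ren (B ⇒ A) {ρ = ρ} {T = T} s (w , k) = WN-ren s w ,
    λ {L″} {σ} s′ V r → subst (λ X → Reducible A L″ (app V X)) (ren-∘ σ ρ T) (k (⊇-∘ s′ s) V r)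

  reducible-↑ : ∀ A {L b X T} → Reducible A L T → Reducible A (L , b [ X ]) (↑ T)
  reducible-↑ A {T = T} r = subst (Reducible A _) (sym (lift≡ren 0 T)) (reducible-ren A ⊇-wk r)

  reducible-expand : ∀ A {L T T′} → L ⊢ T ⟶₀* T′ → Reducible A L T′ → Reducible A L T
  reducible-expand ○       st (N , st′ , nf) = N , st ◅◅ st′ , nf
  reducible-expand (B ⇒ A) st ((N , st′ , nf) , k) = (N , st ◅◅ st′ , nf) ,
    λ s V r → reducible-expand A (gmap (app V) appT (⟶₀*-ren s st)) (k s V r)

  neutral-reducible : ∀ A {L T} → Neutral (binders L) T → Reducible A L T
  neutral-reducible ○       ne = _ , ε , nne ne
  neutral-reducible (B ⇒ A) {T = T} ne = (T , ε , nne ne) , applied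
    where
      applied : ∀ {L′ ρ} → L′ ⊇[ ρ ] _ → ∀ V → Reducible B L′ V → Reducible A L′ (app V (ren ρ T))
      applied s V r with reducible⇒WN B r
      ... | V′ , st , nf =
        reducible-expand A (gmap (λ X → app X _) appV st) (neutral-reducible A (napp nf (neutral-ren s ne)))

  -- A definition whose body is reducible is reducible; at arrow arities the
  -- argument is pushed under the definition by θ.
  reducible-def : ∀ A {L X T} → Reducible A (L , abbr [ X ]) T → Reducible A L (bind abbr X T)
  reducible-def ○       r       = WN-def r
  reducible-def (B ⇒ A) (w , k) = WN-def w ,
    λ s V r → reducible-expand A (theta ◅ ε) (reducible-def A (k (⊇-keep s) (↑ V) (reducible-↑ B r)))

  data Instantiates : Env S → OPE → Env S → Set where
    i-nil  : Instantiates ∅ id ∅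
    i-skip : ∀ {L′ ρ L b X} → Instantiates L′ ρ L → Instantiates (L′ , b [ X ]) (skip ρ) L
    i-keep : ∀ {L′ ρ L b V V′} → Instantiates L′ ρ L → V′ ≡ ren ρ V →
             Instantiates (L′ , b [ V′ ]) (keep ρ) (L , b [ V ])
    i-def  : ∀ {L′ ρ L W B V} → Instantiates L′ ρ L → HasArity L W B → Reducible B L′ V →
             Instantiates (L′ , abbr [ V ]) (keep ρ) (L , abst [ W ])

  -- Instantiations can be further extended (needed for the Kripke clause).
  instantiates-ext : ∀ {L″ σ L′ ρ L} → L″ ⊇[ σ ] L′ → Instantiates L′ ρ L →
                     Instantiates L″ (σ ∘ ρ) L
  instantiates-ext ⊇-id       i = i
  instantiates-ext (⊇-skip s) i = i-skip (instantiates-ext s i)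
  instantiates-ext {σ = keep σ} (⊇-keep {b = b} {V = V} s) (i-skip i) =
    i-skip {b = b} {X = ren σ V} (instantiates-ext s i)
  instantiates-ext {σ = keep σ} (⊇-keep s) (i-keep {ρ = ρ} {V = V} i e) =
    i-keep (instantiates-ext s i) (trans (cong (ren σ) e) (sym (ren-∘ σ ρ V)))
  instantiates-ext (⊇-keep s) (i-def {W = W} {B = B} i d r) =
    i-def {W = W} (instantiates-ext s i) d (reducible-ren B s r)

  instantiates-refl : ∀ L → Σ OPE (λ ρ → Instantiates L ρ L × IsId ρ)
  instantiates-refl ∅ = id , i-nil , λ _ → refl
  instantiates-refl (L , b [ V ]) with instantiates-refl L
  ... | ρ , i , p = keep ρ , i-keep {b = b} i (sym (ren-IsId p V)) , keep-IsId
    where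
      keep-IsId : IsId (keep ρ)
      keep-IsId zero    = refl
      keep-IsId (suc j) = cong suc (p j)

  abstraction-reducible : ∀ {L W T A B L′ ρ} → HasArity L W B → HasArity (L , abst [ W ]) T A →
    Instantiates L′ ρ L → Reducible (B ⇒ A) L′ (ren ρ (bind abst W T))
  fundamental : ∀ {L T A L′ ρ} → HasArity L T A → Instantiates L′ ρ L → Reducible A L′ (ren ρ T)
  fundamental aSort i = _ , ε , nsort
  fundamental {A = A} (aZero d) (i-skip i) = reducible-ren A ⊇-wk (fundamental (aZero d) i)
  fundamental {A = A} (aSuc d)  (i-skip i) = reducible-ren A ⊇-wk (fundamental (aSuc d) i)
  fundamental {A = A} (aZero d) (i-keep {b = abst} i e) = neutral-reducible A (nvar here)
  fundamental {A = A} (aZero d) (i-keep {b = abbr} i e) =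
    reducible-expand A (delta ◅ ε) (reducible-↑ A (subst (Reducible A _) (sym e) (fundamental d i)))
  fundamental {A = A} (aZero d) (i-def i d′ r) with arity-unique d d′
  ... | refl = reducible-expand A (delta ◅ ε) (reducible-↑ A r)
  fundamental {A = A} (aSuc d) (i-keep i e)   = reducible-ren A ⊇-wk (fundamental d i)
  fundamental {A = A} (aSuc d) (i-def i d′ r) = reducible-ren A ⊇-wk (fundamental d i)
  fundamental (aAbst dW dT) i = abstraction-reducible dW dT i
  fundamental (aAbbr {A = A} dV dT) i = reducible-def A (fundamental dT (i-keep {b = abbr} i refl))
  fundamental {A = A} {ρ = ρ} (aApp {T = T} dV dT) i with fundamental dT i
  ... | _ , k = subst (λ X → Reducible A _ (app _ X)) (ren-id (ren ρ T)) (k ⊇-id _ (fundamental dV i))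
  fundamental {A = A} (aCast dU dT) i = reducible-expand A (eps ◅ ε) (fundamental dT i)

  -- A λ-abstraction is normalising because its type and body are, and its
  -- applications β-reduce to a definition of the (cast) argument, which is
  -- an instantiation of the λ-entry.
  abstraction-reducible {W = W} {T} {A} {B} {L′} {ρ} dW dT i = normalising , applied
    where
      normalising : WN L′ (bind abst (ren ρ W) (ren (keep ρ) T))
      normalising with reducible⇒WN B (fundamental dW i)
                     | reducible⇒WN A (fundamental dT (i-keep {b = abst} i refl))
      ... | W′ , sW , nW | T′ , sT , nT =
        _ , gmap (bind abst _) bindT sT ◅◅ gmap (λ X → bind abst X T′) bindV sW , nlam nW nT
      applied : ∀ {L″ σ} → L″ ⊇[ σ ] L′ → ∀ V → Reducible B L″ V →
                Reducible A L″ (app V (ren σ (bind abst (ren ρ W) (ren (keep ρ) T))))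
      applied {σ = σ} s V r = reducible-expand A (beta ◅ ε) (reducible-def A
        (subst (Reducible A _) (ren-∘ (keep σ) (keep ρ) T)
          (fundamental dT (i-def (instantiates-ext s i) dW (reducible-expand B (eps ◅ ε) r)))))

  weak-normalisation : ∀ {L T A} → HasArity L T A → WN L T
  weak-normalisation {L} {T} {A} d with instantiates-refl L
  ... | ρ , i , p = reducible⇒WN A (subst (Reducible A L) (ren-IsId p T) (fundamental d i))

theorem5p2 : (S : Set) → DecidableEquality S → S → (next : S → S) →
    (L : Env S) (T₁ : Term S) (A : Arity) → HasArity L T₁ A →
    (n : ℕ) → Σ (Term S) (λ T₂ → Steps next L T₁ n T₂ × RNormal next L T₂)
theorem5p2 S _ _ next L T₁ A d n with n-steps next n d
... | T , T₁→T , dT with weak-normalisation next dT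
... | N , T→N , N-normal =
  N , subst (λ m → Steps next L T₁ m N) (+-identityʳ n) (trans* T₁→T (⟶₀*⇒Steps next T→N)) ,
  normal⇒RNormal next N-normal
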